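{- For a deck $D$ of order $n$, the following are equivalent: 1. the number of cards of $D$ equals $\Delta_n=n^2-n+1$; 2. $D$ is $n$-symmetric; 3. $D$ is paired.
   Context: A deck consists of a finite set $S$ of symbols together with a finite collection $D$ of distinct cards, each card being a subset of $S$, satisfying: (D1) any two distinct cards have exactly one symbol in common; (D2) every symbol of $S$ lies on at least two cards; (D3) every card contains at least two symbols; (D4) all cards have the same cardinality $n$ (the order); (D5) $S$ is nonempty. A deck is $n$-symmetric if every symbol lies on exactly $n$ cards. A deck is paired if any two distinct symbols lie on exactly one card. -}

module Defs where

open import Data.Nat using (ℕ; _≥_; _*_; _+_; _∸_)
open import Data.Fin using (Fin)
open import Data.Fin.Subset using (Subset; ∣_∣; _∩_; _∈_; Nonempty)
open import Data.Vec using (tabulate; lookup)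
open import Data.Product using (_×_; Σ; ∃; _,_)
open import Relation.Binary.PropositionalEquality using (_≡_; _≢_)
open import Relation.Nullary using (¬_)

-- A deck with s symbols (S = Fin s) and c cards; card i is the subset cards i of S.
-- Cards are listed by an index set Fin c; distinctness of cards = injectivity.
record IsDeck (s c n : ℕ) (cards : Fin c → Subset s) : Set where
  field
    distinct   : ∀ i j → cards i ≡ cards j → i ≡ j
    oneCommon  : ∀ i j → i ≢ j → ∣ cards i ∩ cards j ∣ ≡ 1
    symbolOn2  : ∀ (x : Fin s) → Σ (Fin c) λ i → Σ (Fin c) λ j →
                   i ≢ j × x ∈ cards i × x ∈ cards j
    cardHas2   : ∀ i → ∣ cards i ∣ ≥ 2
    order      : ∀ i → ∣ cards i ∣ ≡ n
    nonemptyS  : Fin s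

cardsThrough : ∀ {s c} → (Fin c → Subset s) → Fin s → Subset c
cardsThrough cards x = tabulate (λ i → lookup (cards i) x)

Symmetric : ∀ {s c} → ℕ → (Fin c → Subset s) → Set
Symmetric n cards = ∀ x → ∣ cardsThrough cards x ∣ ≡ n

Paired : ∀ {s c} → (Fin c → Subset s) → Set
Paired {s} {c} cards =
  ∀ (x y : Fin s) → x ≢ y →
    Σ (Fin c) λ i → (x ∈ cards i × y ∈ cards i) ×
      (∀ j → x ∈ cards j → y ∈ cards j → j ≡ i)

Δ : ℕ → ℕ
Δ n = n * n ∸ n + 1

-- Write r x for the number of cards through x. Counting incidences along a card P gives
-- Σ_{x ∈ P} r x = n + c - 1. For x ∉ P the cards through x meet P in pairwise distinct
-- symbols, so r x ≤ n, with equality iff x is joined by a card to every symbol of P.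
-- Hence c = n² - n + 1 forces r x = n on every card, i.e. everywhere; r ≡ n gives back
-- c = n² - n + 1; and r ≡ n says exactly that any two symbols are joined.
module Submission where

open import Defs
open import Data.Bool using (Bool; true; false; _∧_)
open import Data.Fin using (Fin; zero; suc; punchIn) renaming (_≟_ to _≟ᶠ_)
open import Data.Fin.Properties using (any?; punchInᵢ≢i)
open import Data.Fin.Subset using (Subset; ∣_∣; _∩_; _∈_; _∉_; ⁅_⁆; _⊆_; Nonempty)
open import Data.Fin.Subset.Properties
  using (_∈?_; nonempty?; Empty-unique; ∣⊥∣≡0; x∈⁅x⁆; ∣⁅x⁆∣≡1; p⊆q⇒∣p∣≤∣q∣;
         x∈p⇒∣p-x∣<∣p∣; x∈p∧x≢y⇒x∈p-y; x∈p∩q⁺; x∈p∩q⁻)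
open import Data.Nat using (ℕ; zero; suc; _+_; _*_; _∸_; _≤_; _<_; z≤n; s≤s)
open import Data.Nat.Properties
open import Data.Product using (_×_; ∃; _,_; proj₁)
open import Data.Vec using ([]; _∷_; lookup)
open import Data.Vec.Properties using (lookup-zipWith; lookup∘tabulate; []=⇒lookup; lookup⇒[]=)
open import Function using (_∘_)
open import Function.Bundles using (_⇔_; mk⇔; Equivalence)
open import Relation.Binary.PropositionalEquality
open import Relation.Nullary using (yes; no; ¬?; contradiction)
open import Relation.Nullary.Decidable using (_×-dec_; decidable-stable)
open import Algebra.Properties.CommutativeSemigroup *-commutativeSemigroup using (x∙yz≈y∙xz)
open import Algebra.Properties.Semiring.Sum +-*-semiring
  using (sum; sum-syntax; ∑-comm; sum-remove; sum-cong-≗; *-distribˡ-sum; *-distribʳ-sum)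

∑-const : ∀ k a → ∑[ i < k ] a ≡ k * a
∑-const zero    a = refl
∑-const (suc k) a = cong (a +_) (∑-const k a)

∑-mono-≤ : ∀ {k} {f g : Fin k → ℕ} → (∀ i → f i ≤ g i) → sum f ≤ sum g
∑-mono-≤ {zero}  f≤g = z≤n
∑-mono-≤ {suc k} f≤g = +-mono-≤ (f≤g zero) (∑-mono-≤ (λ i → f≤g (suc i)))

+-mono-≤-≡⇒≡ : ∀ {a b c d} → a ≤ b → c ≤ d → a + c ≡ b + d → a ≡ b × c ≡ d
+-mono-≤-≡⇒≡ {a} {b} {c} {d} a≤b c≤d eq = a≡b , +-cancelˡ-≡ a c d (trans eq (cong (_+ d) (sym a≡b)))
  where
  a≡b : a ≡ b
  a≡b = ≤-antisym a≤b (+-cancelʳ-≤ d b a (≤-trans (≤-reflexive (sym eq)) (+-monoʳ-≤ a c≤d)))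

∑-mono-≤-≡⇒≗ : ∀ {k} {f g : Fin k → ℕ} → (∀ i → f i ≤ g i) → sum f ≡ sum g → ∀ i → f i ≡ g i
∑-mono-≤-≡⇒≗ {suc k} f≤g eq i
  with +-mono-≤-≡⇒≡ (f≤g zero) (∑-mono-≤ (λ j → f≤g (suc j))) eq
∑-mono-≤-≡⇒≗ {suc k} f≤g eq zero    | head≡ , _ = head≡
∑-mono-≤-≡⇒≗ {suc k} f≤g eq (suc i) | _ , tail≡ = ∑-mono-≤-≡⇒≗ (λ j → f≤g (suc j)) tail≡ i

χ : Bool → ℕ
χ true  = 1
χ false = 0

χ-∧ : ∀ a b → χ (a ∧ b) ≡ χ a * χ b
χ-∧ true  b = sym (+-identityʳ (χ b))
χ-∧ false b = refl

χ-idem : ∀ a → χ a * χ a ≡ χ a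
χ-idem true  = refl
χ-idem false = refl

∣p∣≡∑χ : ∀ {k} (p : Subset k) → ∣ p ∣ ≡ ∑[ i < k ] χ (lookup p i)
∣p∣≡∑χ []          = refl
∣p∣≡∑χ (true  ∷ p) = cong suc (∣p∣≡∑χ p)
∣p∣≡∑χ (false ∷ p) = ∣p∣≡∑χ p

module _ {k : ℕ} where

  χ-∈ : ∀ {x} {p : Subset k} → x ∈ p → χ (lookup p x) ≡ 1
  χ-∈ x∈p = cong χ ([]=⇒lookup x∈p)

  χ-∉ : ∀ {x} {p : Subset k} → x ∉ p → χ (lookup p x) ≡ 0
  χ-∉ {x} {p} x∉p with lookup p x in eq
  ... | true  = contradiction (lookup⇒[]= x p eq) x∉p
  ... | false = refl

  ∣p∩q∣≡∑χ*χ : (p q : Subset k) → ∣ p ∩ q ∣ ≡ ∑[ i < k ] (χ (lookup p i) * χ (lookup q i))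
  ∣p∩q∣≡∑χ*χ p q = trans (∣p∣≡∑χ (p ∩ q))
    (sum-cong-≗ λ i → trans (cong χ (lookup-zipWith _∧_ i p q)) (χ-∧ (lookup p i) (lookup q i)))

  χ∈-*-cancelˡ : ∀ {x a b} {p : Subset k} → x ∈ p → χ (lookup p x) * a ≡ χ (lookup p x) * b → a ≡ b
  χ∈-*-cancelˡ {a = a} {b} x∈p eq =
    trans (sym (*-identityˡ a)) (trans (subst (λ t → t * a ≡ t * b) (χ-∈ x∈p) eq) (*-identityˡ b))

  x∉p∧y∈p⇒x≢y : ∀ {x y} {p : Subset k} → x ∉ p → y ∈ p → x ≢ y
  x∉p∧y∈p⇒x≢y x∉p y∈p refl = x∉p y∈p

  x∈p⇒0<∣p∣ : ∀ {x} {p : Subset k} → x ∈ p → 0 < ∣ p ∣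
  x∈p⇒0<∣p∣ x∈p = ≤-trans (s≤s z≤n) (x∈p⇒∣p-x∣<∣p∣ x∈p)

  0<∣p∣⇒Nonempty : ∀ {p : Subset k} → 0 < ∣ p ∣ → Nonempty p
  0<∣p∣⇒Nonempty {p} 0<∣p∣ with nonempty? p
  ... | yes ne = ne
  ... | no empty = contradiction (trans (cong ∣_∣ (Empty-unique empty)) (∣⊥∣≡0 k)) (>⇒≢ 0<∣p∣)

  distinct∈p⇒2≤∣p∣ : ∀ {x y} {p : Subset k} → x ∈ p → y ∈ p → x ≢ y → 2 ≤ ∣ p ∣
  distinct∈p⇒2≤∣p∣ x∈p y∈p x≢y =
    ≤-trans (s≤s (x∈p⇒0<∣p∣ (x∈p∧x≢y⇒x∈p-y y∈p (x≢y ∘ sym)))) (x∈p⇒∣p-x∣<∣p∣ x∈p)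

  subsingleton⇒∣p∣≤1 : ∀ {p : Subset k} → (∀ {x y} → x ∈ p → y ∈ p → x ≡ y) → ∣ p ∣ ≤ 1
  subsingleton⇒∣p∣≤1 {p} unique with nonempty? p
  ... | yes (x , x∈p) = ≤-trans (p⊆q⇒∣p∣≤∣q∣ p⊆⁅x⁆) (≤-reflexive (∣⁅x⁆∣≡1 x))
    where
    p⊆⁅x⁆ : p ⊆ ⁅ x ⁆
    p⊆⁅x⁆ y∈p = subst (_∈ ⁅ x ⁆) (unique x∈p y∈p) (x∈⁅x⁆ x)
  ... | no empty = ≤-trans (≤-reflexive (trans (cong ∣_∣ (Empty-unique empty)) (∣⊥∣≡0 k))) z≤n

  2≤∣p∣⇒∃-other : ∀ {p : Subset k} → 2 ≤ ∣ p ∣ → ∀ x → ∃ λ y → y ∈ p × y ≢ x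
  2≤∣p∣⇒∃-other {p} 2≤∣p∣ x with any? (λ y → (y ∈? p) ×-dec ¬? (y ≟ᶠ x))
  ... | yes other = other
  ... | no none   = contradiction (subsingleton⇒∣p∣≤1 λ y∈p z∈p → trans (only-x y∈p) (sym (only-x z∈p)))
                                  (<⇒≱ 2≤∣p∣)
    where
    only-x : ∀ {y} → y ∈ p → y ≡ x
    only-x {y} y∈p = decidable-stable (y ≟ᶠ x) (λ y≢x → none (y , y∈p , y≢x))

∑-+1-exceptional : ∀ {k} (f : Fin k → ℕ) i → (∀ j → j ≢ i → f j ≡ 1) → sum f + 1 ≡ f i + k
∑-+1-exceptional {suc k} f i others≡1 = begin
  sum f + 1                      ≡⟨ cong (_+ 1) (sum-remove {i = i} f) ⟩
  f i + sum (f ∘ punchIn i) + 1  ≡⟨ cong (λ t → f i + t + 1) rest≡k ⟩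
  f i + k + 1                    ≡⟨ +-assoc (f i) k 1 ⟩
  f i + (k + 1)                  ≡⟨ cong (f i +_) (+-comm k 1) ⟩
  f i + suc k                    ∎
  where
  open ≡-Reasoning
  rest≡k : sum (f ∘ punchIn i) ≡ k
  rest≡k = trans (sum-cong-≗ (λ j → others≡1 _ (punchInᵢ≢i i j))) (trans (∑-const k 1) (*-identityʳ k))

n≤n*n : ∀ n → n ≤ n * n
n≤n*n zero        = z≤n
n≤n*n n@(suc _) = m≤m*n n n

n+Δn≡n*n+1 : ∀ n → n + Δ n ≡ n * n + 1
n+Δn≡n*n+1 n = trans (sym (+-assoc n (n * n ∸ n) 1)) (cong (_+ 1) (m+[n∸m]≡n (n≤n*n n)))

module Deck {s c n : ℕ} {cards : Fin c → Subset s} (deck : IsDeck s c n cards) where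
  open IsDeck deck

  inc : Fin c → Fin s → ℕ
  inc j x = χ (lookup (cards j) x)

  through : Fin s → Subset c
  through = cardsThrough cards

  ∈through⁺ : ∀ {j x} → x ∈ cards j → j ∈ through x
  ∈through⁺ {j} {x} x∈j = lookup⇒[]= j (through x)
    (trans (lookup∘tabulate (λ i → lookup (cards i) x) j) ([]=⇒lookup x∈j))

  ∈through⁻ : ∀ {j x} → j ∈ through x → x ∈ cards j
  ∈through⁻ {j} {x} j∈x = lookup⇒[]= x (cards j)
    (trans (sym (lookup∘tabulate (λ i → lookup (cards i) x) j)) ([]=⇒lookup j∈x))

  ∣through∣≡∑inc : ∀ x → ∣ through x ∣ ≡ ∑[ j < c ] inc j x
  ∣through∣≡∑inc x = trans (∣p∣≡∑χ (through x))
    (sum-cong-≗ λ j → cong χ (lookup∘tabulate (λ i → lookup (cards i) x) j))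

  ∣through∩through∣≡∑inc*inc : ∀ x y → ∣ through x ∩ through y ∣ ≡ ∑[ j < c ] (inc j x * inc j y)
  ∣through∩through∣≡∑inc*inc x y = trans (∣p∩q∣≡∑χ*χ (through x) (through y))
    (sum-cong-≗ λ j → cong₂ _*_ (cong χ (lookup∘tabulate (λ i → lookup (cards i) x) j))
                                  (cong χ (lookup∘tabulate (λ i → lookup (cards i) y) j)))

  ∑inc≡n : ∀ j → ∑[ x < s ] inc j x ≡ n
  ∑inc≡n j = trans (sym (∣p∣≡∑χ (cards j))) (order j)

  ∑inc*inc≡1 : ∀ {j k} → j ≢ k → ∑[ x < s ] (inc j x * inc k x) ≡ 1
  ∑inc*inc≡1 {j} {k} j≢k = trans (sym (∣p∩q∣≡∑χ*χ (cards j) (cards k))) (oneCommon j k j≢k)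

  cards-through-two-symbols-equal : ∀ {x y j k} → x ≢ y →
    x ∈ cards j → y ∈ cards j → x ∈ cards k → y ∈ cards k → j ≡ k
  cards-through-two-symbols-equal {j = j} {k} x≢y x∈j y∈j x∈k y∈k with j ≟ᶠ k
  ... | yes j≡k = j≡k
  ... | no  j≢k = contradiction (oneCommon j k j≢k)
    (>⇒≢ (distinct∈p⇒2≤∣p∣ (x∈p∩q⁺ (x∈j , x∈k)) (x∈p∩q⁺ (y∈j , y∈k)) x≢y))

  ∣through∩through∣≤1 : ∀ {x y} → x ≢ y → ∣ through x ∩ through y ∣ ≤ 1
  ∣through∩through∣≤1 {x} {y} x≢y = subsingleton⇒∣p∣≤1 λ j∈ k∈ →
    let (j∈x , j∈y) = x∈p∩q⁻ (through x) (through y) j∈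
        (k∈x , k∈y) = x∈p∩q⁻ (through x) (through y) k∈
    in cards-through-two-symbols-equal x≢y (∈through⁻ j∈x) (∈through⁻ j∈y) (∈through⁻ k∈x) (∈through⁻ k∈y)

  card-through-avoiding : ∀ {x y} → x ≢ y → ∃ λ P → y ∈ cards P × x ∉ cards P
  card-through-avoiding {x} {y} x≢y with symbolOn2 y
  ... | i , j , i≢j , y∈i , y∈j with x ∈? cards i | x ∈? cards j
  ... | no x∉i | _       = i , y∈i , x∉i
  ... | yes _  | no x∉j  = j , y∈j , x∉j
  ... | yes x∈i | yes x∈j = contradiction (cards-through-two-symbols-equal x≢y x∈i y∈i x∈j y∈j) i≢j

  card-avoiding : ∀ x → ∃ λ P → x ∉ cards P
  card-avoiding x with symbolOn2 x
  ... | i , _ with 2≤∣p∣⇒∃-other {p = cards i} (cardHas2 i) x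
  ...   | y , _ , y≢x with card-through-avoiding (y≢x ∘ sym)
  ...     | P , _ , x∉P = P , x∉P

  -- Every card through x meets P exactly once, which lets us count them along P.
  ∣through∣≡∑inc*∣through∩through∣ : ∀ {x P} → x ∉ cards P →
    ∣ through x ∣ ≡ ∑[ y < s ] (inc P y * ∣ through x ∩ through y ∣)
  ∣through∣≡∑inc*∣through∩through∣ {x} {P} x∉P = begin
    ∣ through x ∣                                          ≡⟨ ∣through∣≡∑inc x ⟩
    ∑[ j < c ] inc j x                                     ≡⟨ sum-cong-≗ meets-P-once ⟨
    ∑[ j < c ] (inc j x * ∑[ y < s ] (inc P y * inc j y))  ≡⟨ sum-cong-≗ (λ j → *-distribˡ-sum (inc j x) (λ y → inc P y * inc j y)) ⟩
    ∑[ j < c ] ∑[ y < s ] (inc j x * (inc P y * inc j y))  ≡⟨ ∑-comm (λ j y → inc j x * (inc P y * inc j y)) ⟩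
    ∑[ y < s ] ∑[ j < c ] (inc j x * (inc P y * inc j y))  ≡⟨ sum-cong-≗ (λ y → sum-cong-≗ (λ j → x∙yz≈y∙xz (inc j x) (inc P y) (inc j y))) ⟩
    ∑[ y < s ] ∑[ j < c ] (inc P y * (inc j x * inc j y))  ≡⟨ sum-cong-≗ (λ y → *-distribˡ-sum (inc P y) (λ j → inc j x * inc j y)) ⟨
    ∑[ y < s ] (inc P y * ∑[ j < c ] (inc j x * inc j y))  ≡⟨ sum-cong-≗ (λ y → cong (inc P y *_) (∣through∩through∣≡∑inc*inc x y)) ⟨
    ∑[ y < s ] (inc P y * ∣ through x ∩ through y ∣)       ∎
    where
    open ≡-Reasoning
    meets-P-once : ∀ j → inc j x * ∑[ y < s ] (inc P y * inc j y) ≡ inc j x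
    meets-P-once j with x ∈? cards j
    ... | yes x∈j = trans (cong (inc j x *_) (∑inc*inc≡1 P≢j)) (*-identityʳ (inc j x))
      where
      P≢j : P ≢ j
      P≢j refl = x∉P x∈j
    ... | no x∉j rewrite χ-∉ x∉j = refl

  inc*∣through∩through∣≤inc : ∀ {x P} → x ∉ cards P → ∀ y → inc P y * ∣ through x ∩ through y ∣ ≤ inc P y
  inc*∣through∩through∣≤inc {x} {P} x∉P y with y ∈? cards P
  ... | yes y∈P = ≤-trans (*-monoʳ-≤ (inc P y) (∣through∩through∣≤1 x≢y)) (≤-reflexive (*-identityʳ (inc P y)))
    where
    x≢y = x∉p∧y∈p⇒x≢y x∉P y∈P
  ... | no y∉P rewrite χ-∉ y∉P = z≤n

  ∣through∣≤n : ∀ x → ∣ through x ∣ ≤ n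
  ∣through∣≤n x with card-avoiding x
  ... | P , x∉P = begin
    ∣ through x ∣                                     ≡⟨ ∣through∣≡∑inc*∣through∩through∣ x∉P ⟩
    ∑[ y < s ] (inc P y * ∣ through x ∩ through y ∣)  ≤⟨ ∑-mono-≤ (inc*∣through∩through∣≤inc x∉P) ⟩
    ∑[ y < s ] inc P y                                ≡⟨ ∑inc≡n P ⟩
    n                                                 ∎
    where open ≤-Reasoning

  ∣through∣≡n⇔joined : ∀ {x P} → x ∉ cards P →
    ∣ through x ∣ ≡ n ⇔ (∀ y → y ∈ cards P → ∣ through x ∩ through y ∣ ≡ 1)
  ∣through∣≡n⇔joined {x} {P} x∉P = mk⇔ to from
    where
    to : ∣ through x ∣ ≡ n → ∀ y → y ∈ cards P → ∣ through x ∩ through y ∣ ≡ 1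
    to r≡n y y∈P = χ∈-*-cancelˡ y∈P (trans pointwise (sym (*-identityʳ (inc P y))))
      where
      pointwise : inc P y * ∣ through x ∩ through y ∣ ≡ inc P y
      pointwise = ∑-mono-≤-≡⇒≗ (inc*∣through∩through∣≤inc x∉P)
        (trans (sym (∣through∣≡∑inc*∣through∩through∣ x∉P)) (trans r≡n (sym (∑inc≡n P)))) y
    from : (∀ y → y ∈ cards P → ∣ through x ∩ through y ∣ ≡ 1) → ∣ through x ∣ ≡ n
    from joined = trans (∣through∣≡∑inc*∣through∩through∣ x∉P) (trans (sum-cong-≗ pointwise) (∑inc≡n P))
      where
      pointwise : ∀ y → inc P y * ∣ through x ∩ through y ∣ ≡ inc P y
      pointwise y with y ∈? cards P
      ... | yes y∈P = trans (cong (inc P y *_) (joined y y∈P)) (*-identityʳ (inc P y))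
      ... | no y∉P rewrite χ-∉ y∉P = refl

  -- Counting the pairs (x ∈ P, card j ∋ x) by j: P itself contributes n, every other card 1.
  ∑inc*∣through∣+1≡n+c : ∀ P → ∑[ x < s ] (inc P x * ∣ through x ∣) + 1 ≡ n + c
  ∑inc*∣through∣+1≡n+c P = begin
    ∑[ x < s ] (inc P x * ∣ through x ∣) + 1       ≡⟨ cong (_+ 1) (sum-cong-≗ λ x → cong (inc P x *_) (∣through∣≡∑inc x)) ⟩
    ∑[ x < s ] (inc P x * ∑[ j < c ] inc j x) + 1  ≡⟨ cong (_+ 1) (sum-cong-≗ λ x → *-distribˡ-sum (inc P x) (λ j → inc j x)) ⟩
    ∑[ x < s ] ∑[ j < c ] (inc P x * inc j x) + 1  ≡⟨ cong (_+ 1) (∑-comm (λ x j → inc P x * inc j x)) ⟩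
    ∑[ j < c ] ∑[ x < s ] (inc P x * inc j x) + 1  ≡⟨ ∑-+1-exceptional _ P P-meets-others-once ⟩
    ∑[ x < s ] (inc P x * inc P x) + c             ≡⟨ cong (_+ c) (trans (sum-cong-≗ (λ x → χ-idem (lookup (cards P) x))) (∑inc≡n P)) ⟩
    n + c                                          ∎
    where
    open ≡-Reasoning
    P-meets-others-once : ∀ j → j ≢ P → ∑[ x < s ] (inc P x * inc j x) ≡ 1
    P-meets-others-once j j≢P = ∑inc*inc≡1 (j≢P ∘ sym)

  ∑inc*n≡n*n : ∀ P → ∑[ x < s ] (inc P x * n) ≡ n * n
  ∑inc*n≡n*n P = trans (sym (*-distribʳ-sum n (inc P))) (cong (_* n) (∑inc≡n P))

  c≡Δn⇒symmetric : c ≡ Δ n → Symmetric n cards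
  c≡Δn⇒symmetric c≡Δn x with symbolOn2 x
  ... | P , _ , _ , x∈P , _ = χ∈-*-cancelˡ x∈P (∑-mono-≤-≡⇒≗ (λ y → *-monoʳ-≤ (inc P y) (∣through∣≤n y)) ∑≡ x)
    where
    open ≡-Reasoning
    ∑≡ : ∑[ y < s ] (inc P y * ∣ through y ∣) ≡ ∑[ y < s ] (inc P y * n)
    ∑≡ = +-cancelʳ-≡ 1 _ _ (begin
      ∑[ y < s ] (inc P y * ∣ through y ∣) + 1  ≡⟨ ∑inc*∣through∣+1≡n+c P ⟩
      n + c                                     ≡⟨ cong (n +_) c≡Δn ⟩
      n + Δ n                                   ≡⟨ n+Δn≡n*n+1 n ⟩
      n * n + 1                                 ≡⟨ cong (_+ 1) (∑inc*n≡n*n P) ⟨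
      ∑[ y < s ] (inc P y * n) + 1              ∎)

  symmetric⇒c≡Δn : Symmetric n cards → c ≡ Δ n
  symmetric⇒c≡Δn symmetric = +-cancelˡ-≡ n c (Δ n) (begin
    n + c                                     ≡⟨ ∑inc*∣through∣+1≡n+c P ⟨
    ∑[ x < s ] (inc P x * ∣ through x ∣) + 1  ≡⟨ cong (_+ 1) (sum-cong-≗ λ x → cong (inc P x *_) (symmetric x)) ⟩
    ∑[ x < s ] (inc P x * n) + 1              ≡⟨ cong (_+ 1) (∑inc*n≡n*n P) ⟩
    n * n + 1                                 ≡⟨ n+Δn≡n*n+1 n ⟨
    n + Δ n                                   ∎)
    where
    open ≡-Reasoning
    P : Fin c
    P = proj₁ (symbolOn2 nonemptyS)

  common-card⇔0<∣through∩through∣ : ∀ {x y} → (∃ λ j → x ∈ cards j × y ∈ cards j) ⇔ 0 < ∣ through x ∩ through y ∣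
  common-card⇔0<∣through∩through∣ {x} {y} = mk⇔
    (λ (j , x∈j , y∈j) → x∈p⇒0<∣p∣ (x∈p∩q⁺ (∈through⁺ x∈j , ∈through⁺ y∈j)))
    (λ 0<∣∩∣ → let (j , j∈∩) = 0<∣p∣⇒Nonempty 0<∣∩∣
                   (j∈x , j∈y) = x∈p∩q⁻ (through x) (through y) j∈∩
               in j , ∈through⁻ j∈x , ∈through⁻ j∈y)

  symmetric⇒paired : Symmetric n cards → Paired cards
  symmetric⇒paired symmetric x y x≢y with card-through-avoiding x≢y
  ... | P , y∈P , x∉P with Equivalence.from common-card⇔0<∣through∩through∣ (≤-reflexive (sym joined))
    where
    joined : ∣ through x ∩ through y ∣ ≡ 1
    joined = Equivalence.to (∣through∣≡n⇔joined x∉P) (symmetric x) y y∈P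
  ... | j , x∈j , y∈j = j , (x∈j , y∈j) , λ k x∈k y∈k → cards-through-two-symbols-equal x≢y x∈k y∈k x∈j y∈j

  paired⇒symmetric : Paired cards → Symmetric n cards
  paired⇒symmetric paired x with card-avoiding x
  ... | P , x∉P = Equivalence.from (∣through∣≡n⇔joined x∉P) joined
    where
    joined : ∀ y → y ∈ cards P → ∣ through x ∩ through y ∣ ≡ 1
    joined y y∈P with paired x y (x∉p∧y∈p⇒x≢y x∉P y∈P)
    ... | j , x∈j∧y∈j , _ = ≤-antisym (∣through∩through∣≤1 (x∉p∧y∈p⇒x≢y x∉P y∈P))
                                       (Equivalence.to common-card⇔0<∣through∩through∣ (j , x∈j∧y∈j))

mainTheorem17 : (s c n : ℕ) (cards : Fin c → Subset s) → IsDeck s c n cards →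
    ((c ≡ Δ n) ⇔ Symmetric n cards) × (Symmetric n cards ⇔ Paired cards)
mainTheorem17 s c n cards deck =
  mk⇔ c≡Δn⇒symmetric symmetric⇒c≡Δn , mk⇔ symmetric⇒paired paired⇒symmetric
  where open Deck deck
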